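{- For every base $\mathscr{B}$ and every IPL formula $\phi$: $\Vdash_{\mathscr B}\phi$ if and only if, for every base $\mathscr X\supseteq\mathscr B$ and every atom $p$, if $\phi\Vdash_{\mathscr X} p$ then $\Vdash_{\mathscr X} p$.
   Context: Fix a denumerable set $\mathbb{A}$ of atoms. IPL formulas are built from atoms and $\bot$ using $\land,\lor,\to$. An atomic rule has the form $(Q_1\triangleright q_1,\dots,Q_n\triangleright q_n)\Rightarrow q$ with $n\ge 0$, $q,q_i$ atoms and $Q_i$ finite (possibly empty) sets of atoms. A base is a set of atomic rules; $\mathscr{C}\supseteq\mathscr{B}$ means $\mathscr{C}$ extends $\mathscr{B}$. Derivability in a base $\mathscr{B}$ (for finite sets of atoms $S$) is the least relation with: $S\cup\{q\}\vdash_{\mathscr B} q$; and if $(Q_1\triangleright q_1,\dots,Q_n\triangleright q_n)\Rightarrow q\in\mathscr B$ and $S\cup Q_i\vdash_{\mathscr B} q_i$ for all $i$, then $S\vdash_{\mathscr B} q$. Sandqvist's support $\Vdash_{\mathscr B}$ is defined by: $\Vdash_{\mathscr B} p$ iff $\emptyset\vdash_{\mathscr B} p$ (atoms $p$); $\Vdash_{\mathscr B}\phi\to\psi$ iff $\phi\Vdash_{\mathscr B}\psi$; $\Vdash_{\mathscr B}\phi\land\psi$ iff $\Vdash_{\mathscr B}\phi$ and $\Vdash_{\mathscr B}\psi$; $\Vdash_{\mathscr B}\phi\lor\psi$ iff for every $\mathscr C\supseteq\mathscr B$ and every atom $p$, if $\phi\Vdash_{\mathscr C}p$ and $\psi\Vdash_{\mathscr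 C}p$ then $\Vdash_{\mathscr C}p$; $\Vdash_{\mathscr B}\bot$ iff $\Vdash_{\mathscr B}p$ for every atom $p$; for nonempty finite $\Gamma$, $\Gamma\Vdash_{\mathscr B}\phi$ iff for every $\mathscr C\supseteq\mathscr B$, if $\Vdash_{\mathscr C}\psi$ for all $\psi\in\Gamma$ then $\Vdash_{\mathscr C}\phi$. -}

module Defs where

open import Level using (Level; Lift; 0ℓ) renaming (suc to lsuc)
open import Data.Nat using (ℕ)
open import Data.List using (List; []; _∷_; _++_)
open import Data.List.NonEmpty using (List⁺; toList)
open import Data.List.Membership.Propositional using (_∈_)
open import Data.List.Relation.Unary.All using (All)
open import Data.Product using (_×_; _,_)

Atom : Set
Atom = ℕ

data Formula : Set where
  atom : Atom → Formula
  ⊥̇    : Formula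
  _∧̇_  : Formula → Formula → Formula
  _∨̇_  : Formula → Formula → Formula
  _⇒_  : Formula → Formula → Formula

-- Finite sets of atoms, represented as lists (only membership matters).
AtomSet : Set
AtomSet = List Atom

record Premise : Set where
  constructor _▷_
  field
    hyps : AtomSet
    goal : Atom

record Rule : Set where
  constructor _⟹_
  field
    premises   : List Premise
    conclusion : Atom

Base : Set₁
Base = Rule → Set

_⊆ᴮ_ : Base → Base → Set
ℬ ⊆ᴮ 𝒞 = ∀ r → ℬ r → 𝒞 r

data _⊢[_]_ (S : AtomSet) (ℬ : Base) : Atom → Set where
  ax   : ∀ {q} → q ∈ S → S ⊢[ ℬ ] q
  rule : ∀ {ps q} → ℬ (ps ⟹ q) →
         All (λ { (Q ▷ qᵢ) → (S ++ Q) ⊢[ ℬ ] qᵢ }) ps →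
         S ⊢[ ℬ ] q

-- Sandqvist's support ⊩_ℬ φ.  In the → and ∨ clauses the single-premise
-- consequence φ ⊩_𝒞 ψ (for all 𝒟 ⊇ 𝒞, ⊩_𝒟 φ implies ⊩_𝒟 ψ) is unfolded.
⊩[_]_ : Base → Formula → Set₁
⊩[ ℬ ] atom p  = Lift (lsuc 0ℓ) ([] ⊢[ ℬ ] p)
⊩[ ℬ ] ⊥̇       = ∀ p → Lift (lsuc 0ℓ) ([] ⊢[ ℬ ] p)
⊩[ ℬ ] (φ ∧̇ ψ) = (⊩[ ℬ ] φ) × (⊩[ ℬ ] ψ)
⊩[ ℬ ] (φ ∨̇ ψ) = ∀ 𝒞 → ℬ ⊆ᴮ 𝒞 → ∀ p →
                   (∀ 𝒟 → 𝒞 ⊆ᴮ 𝒟 → ⊩[ 𝒟 ] φ → Lift (lsuc 0ℓ) ([] ⊢[ 𝒟 ] p)) →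
                   (∀ 𝒟 → 𝒞 ⊆ᴮ 𝒟 → ⊩[ 𝒟 ] ψ → Lift (lsuc 0ℓ) ([] ⊢[ 𝒟 ] p)) →
                   Lift (lsuc 0ℓ) ([] ⊢[ 𝒞 ] p)
⊩[ ℬ ] (φ ⇒ ψ)  = ∀ 𝒞 → ℬ ⊆ᴮ 𝒞 → ⊩[ 𝒞 ] φ → ⊩[ 𝒞 ] ψ

_⊩⟨_⟩_ : List⁺ Formula → Base → Formula → Set₁
Γ ⊩⟨ ℬ ⟩ φ = ∀ 𝒞 → ℬ ⊆ᴮ 𝒞 → All (λ ψ → ⊩[ 𝒞 ] ψ) (toList Γ) → ⊩[ 𝒞 ] φ

{-# OPTIONS --safe #-}
module Submission where

open import Defs
open import Data.List using (List; []; _∷_; _++_)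
open import Data.List.NonEmpty using ([_])
open import Data.List.Relation.Unary.All using (All; []; _∷_)
open import Data.Product using (_×_; _,_)
open import Level using (lift; lower)

-- For ∧ and → the tests of φ ∧ ψ (resp. φ ⇒ ψ, once φ is
-- available) transfer to the components because the compound formula
-- entails them; for atoms, ⊥ and ∨ a single well-chosen test suffices.

⊆ᴮ-refl : ∀ {ℬ} → ℬ ⊆ᴮ ℬ
⊆ᴮ-refl r ℬr = ℬr

⊆ᴮ-trans : ∀ {ℬ 𝒞 𝒟} → ℬ ⊆ᴮ 𝒞 → 𝒞 ⊆ᴮ 𝒟 → ℬ ⊆ᴮ 𝒟
⊆ᴮ-trans ℬ⊆𝒞 𝒞⊆𝒟 r ℬr = 𝒞⊆𝒟 r (ℬ⊆𝒞 r ℬr)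

mutual
  ⊢-mono : ∀ {S ℬ 𝒞 q} → ℬ ⊆ᴮ 𝒞 → S ⊢[ ℬ ] q → S ⊢[ 𝒞 ] q
  ⊢-mono ℬ⊆𝒞 (ax q∈S)     = ax q∈S
  ⊢-mono ℬ⊆𝒞 (rule r ⊢ps) = rule (ℬ⊆𝒞 _ r) (⊢-mono-premises ℬ⊆𝒞 ⊢ps)

  ⊢-mono-premises : ∀ {S ℬ 𝒞} {ps : List Premise} → ℬ ⊆ᴮ 𝒞 →
    All (λ P → (S ++ Premise.hyps P) ⊢[ ℬ ] Premise.goal P) ps →
    All (λ P → (S ++ Premise.hyps P) ⊢[ 𝒞 ] Premise.goal P) ps
  ⊢-mono-premises ℬ⊆𝒞 []         = []
  ⊢-mono-premises ℬ⊆𝒞 (⊢p ∷ ⊢ps) = ⊢-mono ℬ⊆𝒞 ⊢p ∷ ⊢-mono-premises ℬ⊆𝒞 ⊢ps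

⊩-mono : ∀ φ {ℬ 𝒞} → ℬ ⊆ᴮ 𝒞 → ⊩[ ℬ ] φ → ⊩[ 𝒞 ] φ
⊩-mono (atom p) ℬ⊆𝒞 ⊩p       = lift (⊢-mono ℬ⊆𝒞 (lower ⊩p))
⊩-mono ⊥̇       ℬ⊆𝒞 ⊩⊥       = λ p → lift (⊢-mono ℬ⊆𝒞 (lower (⊩⊥ p)))
⊩-mono (φ ∧̇ ψ) ℬ⊆𝒞 (⊩φ , ⊩ψ) = ⊩-mono φ ℬ⊆𝒞 ⊩φ , ⊩-mono ψ ℬ⊆𝒞 ⊩ψ
⊩-mono (φ ∨̇ ψ) ℬ⊆𝒞 ⊩φ∨ψ     = λ 𝒟 𝒞⊆𝒟 → ⊩φ∨ψ 𝒟 (⊆ᴮ-trans ℬ⊆𝒞 𝒞⊆𝒟)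
⊩-mono (φ ⇒ ψ) ℬ⊆𝒞 ⊩φ⇒ψ     = λ 𝒟 𝒞⊆𝒟 → ⊩φ⇒ψ 𝒟 (⊆ᴮ-trans ℬ⊆𝒞 𝒞⊆𝒟)

⊩⟨⟩-intro : ∀ {ℬ φ ψ} → (∀ 𝒞 → ℬ ⊆ᴮ 𝒞 → ⊩[ 𝒞 ] φ → ⊩[ 𝒞 ] ψ) → [ φ ] ⊩⟨ ℬ ⟩ ψ
⊩⟨⟩-intro φ→ψ 𝒞 ℬ⊆𝒞 (⊩φ ∷ []) = φ→ψ 𝒞 ℬ⊆𝒞 ⊩φ

⊩⟨⟩-elim : ∀ {ℬ 𝒞 φ ψ} → [ φ ] ⊩⟨ ℬ ⟩ ψ → ℬ ⊆ᴮ 𝒞 → ⊩[ 𝒞 ] φ → ⊩[ 𝒞 ] ψ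
⊩⟨⟩-elim φ⊩ψ ℬ⊆𝒞 ⊩φ = φ⊩ψ _ ℬ⊆𝒞 (⊩φ ∷ [])

⊩⟨⟩-refl : ∀ {ℬ φ} → [ φ ] ⊩⟨ ℬ ⟩ φ
⊩⟨⟩-refl = ⊩⟨⟩-intro (λ _ _ ⊩φ → ⊩φ)

⊩⟨⟩-trans : ∀ {ℬ χ φ ψ} → [ χ ] ⊩⟨ ℬ ⟩ φ → [ φ ] ⊩⟨ ℬ ⟩ ψ → [ χ ] ⊩⟨ ℬ ⟩ ψ
⊩⟨⟩-trans χ⊩φ φ⊩ψ = ⊩⟨⟩-intro λ 𝒞 ℬ⊆𝒞 ⊩χ →
  ⊩⟨⟩-elim φ⊩ψ ℬ⊆𝒞 (⊩⟨⟩-elim χ⊩φ ℬ⊆𝒞 ⊩χ)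

⊩⟨⟩-mono : ∀ {ℬ 𝒞 φ ψ} → ℬ ⊆ᴮ 𝒞 → [ φ ] ⊩⟨ ℬ ⟩ ψ → [ φ ] ⊩⟨ 𝒞 ⟩ ψ
⊩⟨⟩-mono ℬ⊆𝒞 φ⊩ψ 𝒟 𝒞⊆𝒟 = φ⊩ψ 𝒟 (⊆ᴮ-trans ℬ⊆𝒞 𝒞⊆𝒟)

AtomicConsequencesHold : Base → Formula → Set₁
AtomicConsequencesHold ℬ φ =
  ∀ 𝒳 → ℬ ⊆ᴮ 𝒳 → ∀ p → [ φ ] ⊩⟨ 𝒳 ⟩ atom p → ⊩[ 𝒳 ] atom p

atomicConsequencesHold-mono : ∀ {ℬ 𝒞} φ → ℬ ⊆ᴮ 𝒞 →
  AtomicConsequencesHold ℬ φ → AtomicConsequencesHold 𝒞 φ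
atomicConsequencesHold-mono φ ℬ⊆𝒞 H 𝒳 𝒞⊆𝒳 = H 𝒳 (⊆ᴮ-trans ℬ⊆𝒞 𝒞⊆𝒳)

atomicConsequencesHold-entailed : ∀ {ℬ χ φ} → [ χ ] ⊩⟨ ℬ ⟩ φ →
  AtomicConsequencesHold ℬ χ → AtomicConsequencesHold ℬ φ
atomicConsequencesHold-entailed χ⊩φ H 𝒳 ℬ⊆𝒳 p φ⊩p =
  H 𝒳 ℬ⊆𝒳 p (⊩⟨⟩-trans (⊩⟨⟩-mono ℬ⊆𝒳 χ⊩φ) φ⊩p)

support⇒atomicConsequencesHold : ∀ {ℬ} φ → ⊩[ ℬ ] φ → AtomicConsequencesHold ℬ φ
support⇒atomicConsequencesHold φ ⊩φ 𝒳 ℬ⊆𝒳 p φ⊩p =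
  ⊩⟨⟩-elim φ⊩p ⊆ᴮ-refl (⊩-mono φ ℬ⊆𝒳 ⊩φ)

atomicConsequencesHold⇒support : ∀ {ℬ} φ → AtomicConsequencesHold ℬ φ → ⊩[ ℬ ] φ
atomicConsequencesHold⇒support (atom q) H = H _ ⊆ᴮ-refl q ⊩⟨⟩-refl
atomicConsequencesHold⇒support ⊥̇       H = λ p →
  H _ ⊆ᴮ-refl p (⊩⟨⟩-intro λ _ _ ⊩⊥ → ⊩⊥ p)
atomicConsequencesHold⇒support (φ ∧̇ ψ) H =
    atomicConsequencesHold⇒support φ
      (atomicConsequencesHold-entailed (⊩⟨⟩-intro λ { _ _ (⊩φ , _) → ⊩φ }) H)
  , atomicConsequencesHold⇒support ψ
      (atomicConsequencesHold-entailed (⊩⟨⟩-intro λ { _ _ (_ , ⊩ψ) → ⊩ψ }) H)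
-- The test used is the elimination of φ ∨ ψ itself, performed in the
-- extension 𝒟 where the disjunction is supported.
atomicConsequencesHold⇒support (φ ∨̇ ψ) H = λ 𝒞 ℬ⊆𝒞 p φ⊩p ψ⊩p →
  H 𝒞 ℬ⊆𝒞 p (⊩⟨⟩-intro λ 𝒟 𝒞⊆𝒟 ⊩φ∨ψ →
    ⊩φ∨ψ 𝒟 ⊆ᴮ-refl p (λ ℰ 𝒟⊆ℰ → φ⊩p ℰ (⊆ᴮ-trans 𝒞⊆𝒟 𝒟⊆ℰ))
                       (λ ℰ 𝒟⊆ℰ → ψ⊩p ℰ (⊆ᴮ-trans 𝒞⊆𝒟 𝒟⊆ℰ)))
atomicConsequencesHold⇒support (φ ⇒ ψ) H = λ 𝒞 ℬ⊆𝒞 ⊩φ →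
  atomicConsequencesHold⇒support ψ
    (atomicConsequencesHold-entailed
      (⊩⟨⟩-intro λ 𝒟 𝒞⊆𝒟 ⊩φ⇒ψ → ⊩φ⇒ψ 𝒟 ⊆ᴮ-refl (⊩-mono φ 𝒞⊆𝒟 ⊩φ))
      (atomicConsequencesHold-mono (φ ⇒ ψ) ℬ⊆𝒞 H))

corollary1 : (ℬ : Base) (φ : Formula) →
    (⊩[ ℬ ] φ →
      ∀ 𝒳 → ℬ ⊆ᴮ 𝒳 → ∀ p → [ φ ] ⊩⟨ 𝒳 ⟩ atom p → ⊩[ 𝒳 ] atom p)
    × ((∀ 𝒳 → ℬ ⊆ᴮ 𝒳 → ∀ p → [ φ ] ⊩⟨ 𝒳 ⟩ atom p → ⊩[ 𝒳 ] atom p)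
      → ⊩[ ℬ ] φ)
corollary1 ℬ φ =
  support⇒atomicConsequencesHold φ , atomicConsequencesHold⇒support φ
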